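{- Let $n\ge 5$ and let $x,y$ be integers with $1\le x\le y$. Let $v_1,\dots,v_n$ be the vertices of the cycle $C_n$ in cyclic order, and add two isolated vertices $w_1,w_2$. Set $\lambda(v_k)=F(k)x+F(k-1)y$ for $1\le k\le n$, $\lambda(w_1)=(F(n)+1)x+F(n-1)y$ and $\lambda(w_2)=F(n+1)x+F(n)y$. Then $\lambda$ is a sum labelling of $C_n+N_2$.
   Context: $F$ is the Fibonacci sequence with $F(0)=0$, $F(1)=F(2)=1$, $F(m)=F(m-1)+F(m-2)$. A graph $H=(V,E)$ is a sum graph with sum labelling $\lambda$ if $\lambda:V\to\mathbb{N}$ is injective and $E=\{xy : \exists z\in V,\ \lambda(z)=\lambda(x)+\lambda(y)\}$. $N_2$ is two isolated vertices and $+$ is disjoint union. -}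

module Defs where

open import Data.Nat using (ℕ; zero; suc; _+_; _*_; _∸_; _<_; _<ᵇ_; _≡ᵇ_)
open import Data.Bool using (if_then_else_)
open import Data.Fin using (Fin; toℕ)
open import Data.Product using (Σ; _×_; ∃)
open import Data.Sum using (_⊎_)
open import Relation.Binary.PropositionalEquality using (_≡_; _≢_)
open import Function.Definitions using (Injective)
open import Function.Bundles using (_⇔_)

F : ℕ → ℕ
F zero = 0
F (suc zero) = 1
F (suc (suc m)) = F (suc m) + F m

IsSumLabelling : {m : ℕ} → (Fin m → Fin m → Set) → (Fin m → ℕ) → Set
IsSumLabelling {m} Adj lab =
  Injective _≡_ _≡_ lab ×
  (∀ (u v : Fin m) → u ≢ v → (Adj u v ⇔ (Σ (Fin m) λ w → lab w ≡ lab u + lab v)))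

-- The graph C_n + N_2 on Fin (n + 2): the vertex with index k < n is v_(k+1)
-- (cycle vertices in cyclic order), index n is w_1, index n+1 is w_2.
CycleAdjℕ : ℕ → ℕ → ℕ → Set
CycleAdjℕ n k l =
  k < n × l < n ×
  ((suc k ≡ l) ⊎ (suc l ≡ k) ⊎ (k ≡ 0 × suc l ≡ n) ⊎ (l ≡ 0 × suc k ≡ n))

CnN2 : (n : ℕ) → Fin (n + 2) → Fin (n + 2) → Set
CnN2 n a b = CycleAdjℕ n (toℕ a) (toℕ b)

labℕ : ℕ → ℕ → ℕ → ℕ → ℕ
labℕ n x y k =
  if k <ᵇ n then F (suc k) * x + F k * y
  else if k ≡ᵇ n then (F n + 1) * x + F (n ∸ 1) * y
  else F (suc n) * x + F n * y

lab : (n x y : ℕ) → Fin (n + 2) → ℕ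
lab n x y a = labℕ n x y (toℕ a)

{-# OPTIONS --safe #-}
-- The labels of the cycle vertices form a Fibonacci-like sequence a₀ = x, a₁ = x + y,
-- a(k+2) = a(k+1) + a(k), which is strictly increasing.  Consecutive cycle labels sum to
-- the next term, which is a label (the last one being λ(w₂) = aₙ), and the chord v₁vₙ is
-- witnessed by λ(w₁) = aₙ₋₁ + a₀.  Conversely, in such a sequence aᵢ + aⱼ (i < j) can only
-- be a term if j = i + 1, and can only equal aₖ + a₀ (j ≤ k) if i = 0 and j = k; a sum
-- involving λ(w₂) = aₙ exceeds every label, and one involving λ(w₁) = aₙ₋₁ + a₀ could only
-- be λ(w₂), forcing a₀ + aₖ = aₙ₋₂; but a₀ + aₖ is never a term beyond a₂, and n ≥ 5.
module Submission where

open import Defs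
open import Data.Nat using (ℕ; zero; suc; _+_; _*_; _≤_; _<_; z≤n; s≤s; z<s; _<ᵇ_; _≡ᵇ_)
open import Data.Nat.Properties
open import Data.Nat.Tactic.RingSolver using (solve-∀)
open import Data.Bool using (false)
open import Data.Bool.Properties using (T-≡; ¬-not)
open import Data.Fin using (Fin; toℕ; fromℕ<)
open import Data.Fin.Properties using (toℕ<n; toℕ-injective; toℕ-fromℕ<)
open import Data.Product using (Σ; _×_; _,_; proj₁)
open import Data.Sum using (inj₁; inj₂)
open import Relation.Nullary using (contradiction)
open import Relation.Binary.PropositionalEquality
open import Relation.Binary.Definitions using (tri<; tri≈; tri>)
open import Function.Bundles using (_⇔_; mk⇔; Equivalence)

module StrictlyIncreasingBelow (f : ℕ → ℕ) (b : ℕ)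
    (f-step : ∀ {t} → suc t < b → f t < f (suc t)) where

  mono : ∀ {u v} → u < v → v < b → f u < f v
  mono {u} {suc v} u<1+v 1+v<b with m≤n⇒m<n∨m≡n (≤-pred u<1+v)
  ... | inj₁ u<v  = <-trans (mono u<v (<-trans (n<1+n v) 1+v<b)) (f-step 1+v<b)
  ... | inj₂ refl = f-step 1+v<b

  mono-≤ : ∀ {u v} → u ≤ v → v < b → f u ≤ f v
  mono-≤ u≤v v<b with m≤n⇒m<n∨m≡n u≤v
  ... | inj₁ u<v  = <⇒≤ (mono u<v v<b)
  ... | inj₂ refl = ≤-refl

  cancel-< : ∀ {u v} → u < b → f u < f v → u < v
  cancel-< u<b fu<fv = ≰⇒> (λ v≤u → <⇒≱ fu<fv (mono-≤ v≤u u<b))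

  injective : ∀ {u v} → u < b → v < b → f u ≡ f v → u ≡ v
  injective u<b v<b fu≡fv = ≤-antisym
    (≮⇒≥ (λ v<u → <-irrefl (sym fu≡fv) (mono v<u u<b)))
    (≮⇒≥ (λ u<v → <-irrefl fu≡fv (mono u<v v<b)))

module FibonacciLike (a : ℕ → ℕ)
    (a-rec : ∀ k → a (suc (suc k)) ≡ a (suc k) + a k)
    (0<a₀ : 0 < a 0) (a₀<a₁ : a 0 < a 1) where

  a-positive : ∀ k → 0 < a k
  a-positive zero = 0<a₀
  a-positive (suc zero) = <-trans 0<a₀ a₀<a₁
  a-positive (suc (suc k)) =
    subst (0 <_) (sym (a-rec k)) (≤-trans (a-positive (suc k)) (m≤m+n _ _))

  a-step : ∀ k → a k < a (suc k)
  a-step zero = a₀<a₁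
  a-step (suc k) = subst (a (suc k) <_) (sym (a-rec k)) (m<m+n _ (a-positive k))

  private
    module Below (b : ℕ) = StrictlyIncreasingBelow a b (λ {t} _ → a-step t)

  a-mono : ∀ {i j} → i < j → a i < a j
  a-mono {j = j} i<j = Below.mono (suc j) i<j (n<1+n j)

  a-mono-≤ : ∀ {i j} → i ≤ j → a i ≤ a j
  a-mono-≤ {j = j} i≤j = Below.mono-≤ (suc j) i≤j (n<1+n j)

  a-cancel-< : ∀ {i j} → a i < a j → i < j
  a-cancel-< {i} = Below.cancel-< (suc i) (n<1+n i)

  a-cancel-≤ : ∀ {i j} → a i ≤ a j → i ≤ j
  a-cancel-≤ {j = j} ai≤aj = ≤-pred (a-cancel-< (≤-<-trans ai≤aj (a-step j)))

  a-injective : ∀ {i j} → a i ≡ a j → i ≡ j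
  a-injective e = ≤-antisym (a-cancel-≤ (≤-reflexive e)) (a-cancel-≤ (≤-reflexive (sym e)))

  sum-≤-next : ∀ {i j} → i < j → a i + a j ≤ a (suc j)
  sum-≤-next {i} {suc j} (s≤s i≤j) = begin
    a i + a (suc j)       ≤⟨ +-monoˡ-≤ (a (suc j)) (a-mono-≤ i≤j) ⟩
    a j + a (suc j)       ≡⟨ +-comm (a j) (a (suc j)) ⟩
    a (suc j) + a j       ≡⟨ a-rec j ⟨
    a (suc (suc j))       ∎
    where open ≤-Reasoning

  sum-of-two-terms : ∀ {i j t} → i < j → a i + a j ≡ a t → j ≡ suc i × t ≡ suc j
  sum-of-two-terms {i} {suc j} {t} i<1+j e = sym i≡j' , t≡2+j
    where
    1+j<t : suc j < t
    1+j<t = a-cancel-< (subst (a (suc j) <_) e (m<n+m (a (suc j)) (a-positive i)))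

    t≡2+j : t ≡ suc (suc j)
    t≡2+j = ≤-antisym (a-cancel-≤ (subst (_≤ a (suc (suc j))) e (sum-≤-next i<1+j))) 1+j<t

    i≡j' : suc i ≡ suc j
    i≡j' = cong suc (a-injective (+-cancelʳ-≡ (a (suc j)) (a i) (a j) (begin
      a i + a (suc j)       ≡⟨ e ⟩
      a t                   ≡⟨ cong a t≡2+j ⟩
      a (suc (suc j))       ≡⟨ a-rec j ⟩
      a (suc j) + a j       ≡⟨ +-comm (a (suc j)) (a j) ⟩
      a j + a (suc j)       ∎)))
      where open ≡-Reasoning

  sum-≡-term+first : ∀ {i j k} → i < j → j ≤ k → a i + a j ≡ a k + a 0 → i ≡ 0 × j ≡ k
  sum-≡-term+first {i} {j} {k} i<j j≤k e with m≤n⇒m<n∨m≡n j≤k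
  ... | inj₁ j<k = contradiction (begin-strict
        a k + a 0   ≡⟨ e ⟨
        a i + a j   ≤⟨ sum-≤-next i<j ⟩
        a (suc j)   ≤⟨ a-mono-≤ j<k ⟩
        a k         <⟨ m<m+n (a k) 0<a₀ ⟩
        a k + a 0   ∎) (<-irrefl refl)
    where open ≤-Reasoning
  ... | inj₂ refl =
    a-injective (+-cancelʳ-≡ (a j) (a i) (a 0) (trans e (+-comm (a j) (a 0)))) , refl

  first+term-≡-term : ∀ {k t} → a 0 + a k ≡ a t → t ≤ 2
  first+term-≡-term {zero} e = <⇒≤ (a-cancel-< (subst (_< a 2) e (begin-strict
    a 0 + a 0   <⟨ +-monoʳ-< (a 0) a₀<a₁ ⟩
    a 0 + a 1   ≡⟨ +-comm (a 0) (a 1) ⟩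
    a 1 + a 0   ≡⟨ a-rec 0 ⟨
    a 2         ∎)))
    where open ≤-Reasoning
  first+term-≡-term {suc k} e with sum-of-two-terms z<s e
  ... | refl , refl = ≤-refl

fibCombination : ℕ → ℕ → ℕ → ℕ
fibCombination x y k = F (suc k) * x + F k * y

fibCombination-rec : ∀ x y k →
  fibCombination x y (suc (suc k)) ≡ fibCombination x y (suc k) + fibCombination x y k
fibCombination-rec x y k = distrib (F (suc (suc k))) (F (suc k)) (F (suc k)) (F k) x y
  where
  distrib : ∀ A B C D x y → (A + B) * x + (C + D) * y ≡ (A * x + C * y) + (B * x + D * y)
  distrib = solve-∀

fibCombination-zero : ∀ x y → fibCombination x y 0 ≡ x
fibCombination-zero x y = trans (+-identityʳ (x + 0)) (+-identityʳ x)

fibCombination-one : ∀ x y → fibCombination x y 1 ≡ x + y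
fibCombination-one x y = cong₂ _+_ (*-identityˡ x) (*-identityˡ y)

<ᵇ-false : ∀ {m n} → n ≤ m → (m <ᵇ n) ≡ false
<ᵇ-false {m} {n} n≤m = ¬-not (λ m<ᵇn → <⇒≱ (<ᵇ⇒< m n (Equivalence.from T-≡ m<ᵇn)) n≤m)

≡ᵇ-false : ∀ {m n} → m ≢ n → (m ≡ᵇ n) ≡ false
≡ᵇ-false {m} {n} m≢n = ¬-not (λ m≡ᵇn → m≢n (≡ᵇ⇒≡ m n (Equivalence.from T-≡ m≡ᵇn)))

labℕ-cycle : ∀ {n x y k} → k < n → labℕ n x y k ≡ fibCombination x y k
labℕ-cycle k<n rewrite Equivalence.to T-≡ (<⇒<ᵇ k<n) = refl

labℕ-w₁ : ∀ {m x y} → labℕ (suc m) x y (suc m) ≡ fibCombination x y m + x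
labℕ-w₁ {m} {x} {y}
  rewrite <ᵇ-false {suc m} {suc m} ≤-refl | Equivalence.to T-≡ (≡⇒≡ᵇ m m refl) =
  distrib (F (suc m)) (F m) x y
  where
  distrib : ∀ A B x y → (A + 1) * x + B * y ≡ (A * x + B * y) + x
  distrib = solve-∀

labℕ-w₂ : ∀ {n x y} → labℕ n x y (suc n) ≡ fibCombination x y n
labℕ-w₂ {n} rewrite <ᵇ-false {suc n} {n} (n≤1+n n) | ≡ᵇ-false {suc n} {n} 1+n≢n = refl

<+2⇒≤suc : ∀ {n t} → t < n + 2 → t ≤ suc n
<+2⇒≤suc {n} {t} t<n+2 = ≤-pred (subst (t <_) (+-comm n 2) t<n+2)

data Vertex (n : ℕ) : ℕ → Set where
  cycle : ∀ {k} → k < n → Vertex n k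
  w₁ : Vertex n n
  w₂ : Vertex n (suc n)

vertex : ∀ n {t} → t < n + 2 → Vertex n t
vertex n {t} t<n+2 with <-cmp t n
... | tri< t<n _ _ = cycle t<n
... | tri≈ _ refl _ = w₁
... | tri> _ _ n<t with ≤-antisym (<+2⇒≤suc {n} t<n+2) n<t
... | refl = w₂

CycleAdjℕ-sym : ∀ {n k l} → CycleAdjℕ n l k → CycleAdjℕ n k l
CycleAdjℕ-sym (l<n , k<n , inj₁ e) = k<n , l<n , inj₂ (inj₁ e)
CycleAdjℕ-sym (l<n , k<n , inj₂ (inj₁ e)) = k<n , l<n , inj₁ e
CycleAdjℕ-sym (l<n , k<n , inj₂ (inj₂ (inj₁ e))) = k<n , l<n , inj₂ (inj₂ (inj₂ e))
CycleAdjℕ-sym (l<n , k<n , inj₂ (inj₂ (inj₂ e))) = k<n , l<n , inj₂ (inj₂ (inj₁ e))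

module CycleWithTwoIsolated (j x y : ℕ) (1≤x : 1 ≤ x) (1≤y : 1 ≤ y) where

  m n : ℕ
  m = 4 + j
  n = suc m

  a : ℕ → ℕ
  a = fibCombination x y

  a₀≡x : a 0 ≡ x
  a₀≡x = fibCombination-zero x y

  a-rec : ∀ k → a (suc (suc k)) ≡ a (suc k) + a k
  a-rec = fibCombination-rec x y

  open FibonacciLike a a-rec (subst (0 <_) (sym a₀≡x) 1≤x)
    (subst₂ _<_ (sym a₀≡x) (sym (fibCombination-one x y)) (m<m+n x 1≤y))

  L : ℕ → ℕ
  L = labℕ n x y

  label-cycle : ∀ {k} → k < n → L k ≡ a k
  label-cycle = labℕ-cycle

  label-w₁ : L n ≡ a m + a 0
  label-w₁ = trans (labℕ-w₁ {m}) (cong (a m +_) (sym a₀≡x))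

  label-w₂ : L (suc n) ≡ a n
  label-w₂ = labℕ-w₂ {n}

  label-step : ∀ {t} → suc t < n + 2 → L t < L (suc t)
  label-step {t} 1+t<n+2 with vertex n 1+t<n+2
  ... | cycle 1+t<n = subst₂ _<_ (sym (label-cycle (<-trans (n<1+n t) 1+t<n)))
                                 (sym (label-cycle 1+t<n)) (a-step t)
  ... | w₁ = subst₂ _<_ (sym (label-cycle (n<1+n m))) (sym label-w₁) (m<m+n (a m) (a-positive 0))
  ... | w₂ = subst₂ _<_ (sym label-w₁) (sym (trans label-w₂ (a-rec (3 + j))))
                        (+-monoʳ-< (a m) (a-mono {0} {3 + j} z<s))

  open StrictlyIncreasingBelow L (n + 2) label-step public using ()
    renaming (mono-≤ to label-mono-≤; cancel-< to label-cancel-<; injective to label-injective)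

  <n⇒<n+2 : ∀ {k} → k < n → k < n + 2
  <n⇒<n+2 k<n = <-≤-trans k<n (m≤m+n n 2)

  n<n+2 : n < n + 2
  n<n+2 = m<m+n n z<s

  1+n<n+2 : suc n < n + 2
  1+n<n+2 = subst (suc n <_) (+-comm 2 n) (n<1+n (suc n))

  label-positive : ∀ {t} → t < n + 2 → 0 < L t
  label-positive t<n+2 =
    <-≤-trans (subst (0 <_) (sym (label-cycle z<s)) (a-positive 0)) (label-mono-≤ z≤n t<n+2)

  term-is-label : ∀ {k} → k ≤ n → Σ ℕ λ t → t < n + 2 × L t ≡ a k
  term-is-label {k} k≤n with m≤n⇒m<n∨m≡n k≤n
  ... | inj₁ k<n  = k , <n⇒<n+2 k<n , label-cycle k<n
  ... | inj₂ refl = suc n , 1+n<n+2 , label-w₂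

  consecutive-sum : ∀ {k} → suc k < n → Σ ℕ λ t → t < n + 2 × L t ≡ L k + L (suc k)
  consecutive-sum {k} 1+k<n with term-is-label 1+k<n
  ... | t , t<n+2 , e = t , t<n+2 , (begin
    L t                   ≡⟨ e ⟩
    a (suc (suc k))       ≡⟨ a-rec k ⟩
    a (suc k) + a k       ≡⟨ +-comm (a (suc k)) (a k) ⟩
    a k + a (suc k)       ≡⟨ cong₂ _+_ (label-cycle (<-trans (n<1+n k) 1+k<n)) (label-cycle 1+k<n) ⟨
    L k + L (suc k)       ∎)
    where open ≡-Reasoning

  adjacent⇒sum : ∀ {k l} → CycleAdjℕ n k l → Σ ℕ λ t → t < n + 2 × L t ≡ L k + L l
  adjacent⇒sum (_ , l<n , inj₁ refl) = consecutive-sum l<n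
  adjacent⇒sum {k} {l} (k<n , _ , inj₂ (inj₁ refl)) with consecutive-sum k<n
  ... | t , t<n+2 , e = t , t<n+2 , trans e (+-comm (L l) (L k))
  adjacent⇒sum (_ , _ , inj₂ (inj₂ (inj₁ (refl , refl)))) =
    n , n<n+2 , trans label-w₁ (trans (+-comm (a m) (a 0))
                        (sym (cong₂ _+_ (label-cycle z<s) (label-cycle (n<1+n m)))))
  adjacent⇒sum (_ , _ , inj₂ (inj₂ (inj₂ (refl , refl)))) =
    n , n<n+2 , trans label-w₁ (sym (cong₂ _+_ (label-cycle (n<1+n m)) (label-cycle z<s)))

  label+w₂-not-label : ∀ {k t} → k < n + 2 → t < n + 2 → L t ≢ L k + L (suc n)
  label+w₂-not-label k<n+2 t<n+2 e = <⇒≱ (m<n+m _ (label-positive k<n+2))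
    (subst (_≤ L (suc n)) e (label-mono-≤ (<+2⇒≤suc {n} t<n+2) 1+n<n+2))

  label-above-w₁ : ∀ {t} → t < n + 2 → L n < L t → t ≡ suc n
  label-above-w₁ t<n+2 Ln<Lt = ≤-antisym (<+2⇒≤suc {n} t<n+2) (label-cancel-< n<n+2 Ln<Lt)

  label+w₁-not-label : ∀ {k t} → k < n → t < n + 2 → L t ≢ L k + L n
  label+w₁-not-label {k} k<n t<n+2 e
    with label-above-w₁ t<n+2 (subst (L n <_) (sym e) (m<n+m (L n) (label-positive (<n⇒<n+2 k<n))))
  ... | refl = contradiction (first+term-≡-term {k} {3 + j} (+-cancelˡ-≡ (a m) _ _ (begin
    a m + (a 0 + a k)     ≡⟨ +-assoc (a m) (a 0) (a k) ⟨
    a m + a 0 + a k       ≡⟨ +-comm (a m + a 0) (a k) ⟩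
    a k + (a m + a 0)     ≡⟨ cong₂ _+_ (label-cycle k<n) label-w₁ ⟨
    L k + L n             ≡⟨ e ⟨
    L (suc n)             ≡⟨ label-w₂ ⟩
    a n                   ≡⟨ a-rec (3 + j) ⟩
    a m + a (3 + j)       ∎))) (λ { (s≤s (s≤s ())) })
    where open ≡-Reasoning

  sum⇒adjacent : ∀ {k l t} → k < l → l < n + 2 → t < n + 2 → L t ≡ L k + L l → CycleAdjℕ n k l
  sum⇒adjacent {k} {l} {t} k<l l<n+2 t<n+2 e with vertex n l<n+2
  ... | w₂ = contradiction e (label+w₂-not-label (<-trans k<l l<n+2) t<n+2)
  ... | w₁ = contradiction e (label+w₁-not-label k<l t<n+2)
  ... | cycle l<n = sum-of-cycle-labels (vertex n t<n+2)
                        (trans e (cong₂ _+_ (label-cycle k<n) (label-cycle l<n)))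
    where
    k<n : k < n
    k<n = <-trans k<l l<n

    consecutive : ∀ {s} → a k + a l ≡ a s → CycleAdjℕ n k l
    consecutive {s} e′ = k<n , l<n , inj₁ (sym (proj₁ (sum-of-two-terms {t = s} k<l e′)))

    sum-of-cycle-labels : ∀ {s} → Vertex n s → L s ≡ a k + a l → CycleAdjℕ n k l
    sum-of-cycle-labels {s} (cycle s<n) e′ = consecutive {s} (trans (sym e′) (label-cycle s<n))
    sum-of-cycle-labels w₂ e′ = consecutive {n} (trans (sym e′) label-w₂)
    sum-of-cycle-labels w₁ e′
      with sum-≡-term+first {k = m} k<l (≤-pred l<n) (trans (sym e′) label-w₁)
    ... | k≡0 , l≡m = k<n , l<n , inj₂ (inj₂ (inj₁ (k≡0 , cong suc l≡m)))

lemma9 : (n x y : ℕ) → 5 ≤ n → 1 ≤ x → x ≤ y →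
    IsSumLabelling (CnN2 n) (lab n x y)
lemma9 n@(suc (suc (suc (suc (suc j))))) x y (s≤s (s≤s (s≤s (s≤s (s≤s _))))) 1≤x x≤y =
  injective , adjacency
  where
  open CycleWithTwoIsolated j x y 1≤x (≤-trans 1≤x x≤y)
    using (L; label-injective; adjacent⇒sum; sum⇒adjacent)

  injective : ∀ {u v : Fin (n + 2)} → lab n x y u ≡ lab n x y v → u ≡ v
  injective {u} {v} e = toℕ-injective (label-injective (toℕ<n u) (toℕ<n v) e)

  LabelSum : Fin (n + 2) → Fin (n + 2) → Set
  LabelSum u v = Σ (Fin (n + 2)) λ w → lab n x y w ≡ lab n x y u + lab n x y v

  adjacency : ∀ u v → u ≢ v → CnN2 n u v ⇔ LabelSum u v
  adjacency u v u≢v = mk⇔ sum-of-adjacent adjacent-of-sum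
    where
    sum-of-adjacent : CnN2 n u v → LabelSum u v
    sum-of-adjacent u~v with adjacent⇒sum u~v
    ... | t , t<n+2 , e = fromℕ< t<n+2 , trans (cong L (toℕ-fromℕ< t<n+2)) e

    adjacent-of-sum : LabelSum u v → CnN2 n u v
    adjacent-of-sum (w , e) with <-cmp (toℕ u) (toℕ v)
    ... | tri< u<v _ _ = sum⇒adjacent u<v (toℕ<n v) (toℕ<n w) e
    ... | tri≈ _ u≡v _ = contradiction (toℕ-injective u≡v) u≢v
    ... | tri> _ _ v<u = CycleAdjℕ-sym
      (sum⇒adjacent v<u (toℕ<n u) (toℕ<n w) (trans e (+-comm (L (toℕ u)) (L (toℕ v)))))
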